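{- Let $b$ be a nonzero integer such that $-b$ is not a perfect square and $b$ has a prime divisor $p$ with $p \equiv 3 \pmod 4$. A pair $(X, Y)$ with $X, Y \in M_2(\mathbb{Z})$ satisfies $X^2 + bY^2 = -I$ if and only if one of the following holds: (i) $X = \begin{pmatrix} t_1 & t_2 \\ t_3 & -t_1 \end{pmatrix}$, $Y = \begin{pmatrix} s_1 & s_2 \\ s_3 & -s_1 \end{pmatrix}$ with $t_1, t_2, t_3, s_1, s_2, s_3 \in \mathbb{Z}$ and $t_1^2 + t_2 t_3 + b(s_1^2 + s_2 s_3) = -1$; (ii) if $b > 0$: $X = \begin{pmatrix} t_1 & t_2 \\ t_3 & -t_1 \end{pmatrix}$, $Y = t_4 I$ with $t_1, t_2, t_3, t_4 \in \mathbb{Z}$ and $t_1^2 + t_2 t_3 + b t_4^2 = -1$; if $b < 0$: $X = \begin{pmatrix} t_1 & \frac{u+1}{g} t_2 \\ \frac{u+1}{g} t_3 & -(u t_1 + vb t_4) \end{pmatrix}$, $Y = \begin{pmatrix} t_4 & \frac{v}{g} t_2 \\ \frac{v}{g} t_3 & u t_4 - v t_1 \end{pmatrix}$, where $t_1, t_2, t_3, t_4, u, v \in \mathbb{Z}$, $u \neq -1$, $g = \gcd(v, u+1)$, and $$u^2 + v^2 b = 1, \qquad t_1^2 + b t_4^2 + \frac{2 t_2 t_3}{g^2}(1+u) = -1.$$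
   Context: $M_2(\mathbb{Z})$ denotes the ring of $2\times 2$ matrices with integer entries; $I$ is the $2\times 2$ identity matrix. -}

module Defs where

open import Data.Integer using (ℤ; +_; -_; _+_; _*_; _-_; 0ℤ; 1ℤ)
open import Data.Nat using (ℕ; _%_)
open import Data.Nat.Primality using (Prime)
open import Data.Integer.Divisibility using (_∣_)
open import Data.Product using (Σ; ∃; _×_)
open import Relation.Binary.PropositionalEquality using (_≡_)

record M2 : Set where
  constructor mat
  field
    a₁₁ a₁₂ a₂₁ a₂₂ : ℤ
open M2 public

_+ᴹ_ : M2 → M2 → M2
mat a b c d +ᴹ mat a' b' c' d' = mat (a + a') (b + b') (c + c') (d + d')

_*ᴹ_ : M2 → M2 → M2
mat a b c d *ᴹ mat a' b' c' d' =
  mat (a * a' + b * c') (a * b' + b * d') (c * a' + d * c') (c * b' + d * d')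

_·ᴹ_ : ℤ → M2 → M2
k ·ᴹ mat a b c d = mat (k * a) (k * b) (k * c) (k * d)

-ᴹ_ : M2 → M2
-ᴹ mat a b c d = mat (- a) (- b) (- c) (- d)

I : M2
I = mat 1ℤ 0ℤ 0ℤ 1ℤ

sq : M2 → M2
sq X = X *ᴹ X

IsSquare : ℤ → Set
IsSquare z = ∃ λ k → k * k ≡ z

HasPrime3mod4Divisor : ℤ → Set
HasPrime3mod4Divisor b = ∃ λ (p : ℕ) → Prime p × (+ p) ∣ b × p % 4 ≡ 3

{-# OPTIONS --safe #-}
module Submission where

open import Defs

-- By Cayley–Hamilton, X² + bY² = −I forces τ·[X,Y] = 0 and bσ·[X,Y] = 0 for τ = tr X and σ = tr Y,
-- so either X and Y are both traceless, which is family (i), or they commute.  For commuting X, Y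
-- put M = X + sY with s² = −b, so that M·(X − sY) = −I and det M = u + sv.  Then adj M = −det M·(X − sY)
-- says adj X = −(uX + vbY) and adj Y = uY − vX, and det M·det (X − sY) = 1 is the Pell equation
-- u² + bv² = 1.  Here u = −1 is impossible: it would force the (1,2) entry of X to vanish and hence
-- x² + bk = −1, which cannot hold since −1 is not a square modulo a prime p ≡ 3 (mod 4) dividing b.
-- For b > 1 the Pell equation leaves u = 1, v = 0, that is X traceless and Y scalar.  For b < 0 the
-- relations v·x = (u + 1)·y between corresponding off-diagonal entries of X and Y make them multiples
-- of (u + 1)/g and v/g with g = gcd (v, u + 1), which is family (ii).

module Fermat where

  open import Data.Nat
  open import Data.Nat.Properties
  open import Data.Nat.Divisibility
  open import Data.Nat.DivMod
  open import Data.Nat.Primality using (Prime; ¬prime[1]; euclidsLemma; prime⇒nonZero)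
  open import Data.Nat.Combinatorics using (_C_; nCn≡1; k![n∸k]!∣n!)
  open import Data.Nat.Combinatorics.Specification using (nCk≡n!/k![n-k]!)
  open import Data.Nat.Tactic.RingSolver using (solve-∀)
  open import Data.Fin.Base using (toℕ; inject₁; zero; suc)
  open import Data.Fin.Properties using (toℕ-inject₁; toℕ-fromℕ; toℕ<n)
  open import Data.Vec.Functional using (Vector; init; last; tail)
  open import Data.Sum using (inj₁; inj₂)
  open import Data.Empty using (⊥-elim)
  open import Function.Base using (_∘_)
  open import Relation.Nullary using (¬_)
  open import Relation.Binary.PropositionalEquality
  import Algebra.Definitions.RawMonoid +-0-rawMonoid as Mult
  import Algebra.Properties.Monoid.Sum +-0-monoid as Sum
  import Algebra.Properties.Semiring.Exp +-*-semiring as Exp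
  import Algebra.Properties.CommutativeSemiring.Binomial +-*-commutativeSemiring as Binomial

  nCk*k![n∸k]!≡n! : ∀ {n k} → k ≤ n → (n C k) * (k ! * (n ∸ k) !) ≡ n !
  nCk*k![n∸k]!≡n! {n} {k} k≤n =
    trans (cong (_* (k ! * (n ∸ k) !)) (nCk≡n!/k![n-k]! k≤n)) (m/n*n≡m (k![n∸k]!∣n! k≤n))
    where instance _ = k !* (n ∸ k) !≢0

  n∣n! : ∀ n → .{{NonZero n}} → n ∣ n !
  n∣n! (suc n) = m∣m*n (n !)

  p∣n!⇒p≤n : ∀ {p} → Prime p → ∀ n → p ∣ n ! → p ≤ n
  p∣n!⇒p≤n p-prime zero p∣1 = ⊥-elim (¬prime[1] (subst Prime (∣1⇒≡1 p∣1) p-prime))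
  p∣n!⇒p≤n p-prime (suc n) p∣n! with euclidsLemma (suc n) (n !) p-prime p∣n!
  ... | inj₁ p∣1+n = ∣⇒≤ p∣1+n
  ... | inj₂ p∣n!′ = m≤n⇒m≤1+n (p∣n!⇒p≤n p-prime n p∣n!′)

  p∣pCk : ∀ {p k} → Prime p → 0 < k → k < p → p ∣ p C k
  p∣pCk {p} {k} p-prime 0<k k<p
    with euclidsLemma (p C k) (k ! * (p ∸ k) !) p-prime
           (subst (p ∣_) (sym (nCk*k![n∸k]!≡n! (<⇒≤ k<p))) (n∣n! p {{prime⇒nonZero p-prime}}))
  ... | inj₁ p∣pCk = p∣pCk
  ... | inj₂ p∣k![p∸k]! with euclidsLemma (k !) ((p ∸ k) !) p-prime p∣k![p∸k]!
  ...   | inj₁ p∣k!     = ⊥-elim (<⇒≱ k<p (p∣n!⇒p≤n p-prime k p∣k!))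
  ...   | inj₂ p∣[p∸k]! = ⊥-elim (<⇒≱ (∸-monoʳ-< 0<k (<⇒≤ k<p)) (p∣n!⇒p≤n p-prime (p ∸ k) p∣[p∸k]!))

  ^≡^ : ∀ x n → x Exp.^ n ≡ x ^ n
  ^≡^ x zero    = refl
  ^≡^ x (suc n) = cong (x *_) (^≡^ x n)

  ×≡* : ∀ n x → n Mult.× x ≡ n * x
  ×≡* zero    x = refl
  ×≡* (suc n) x = cong (x +_) (×≡* n x)

  ∣-sum : ∀ {d n} (t : Vector ℕ n) → (∀ i → d ∣ t i) → d ∣ Sum.sum t
  ∣-sum {d} {zero}  t d∣t = d ∣0
  ∣-sum {d} {suc n} t d∣t = ∣m∣n⇒∣m+n (d∣t zero) (∣-sum (tail t) (d∣t ∘ suc))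

  innerBinomialTerms : ∀ m → ℕ → Vector ℕ m
  innerBinomialTerms m a = init (tail (Binomial.binomialTerm 1 a (suc m)))

  binomial-ends : ∀ m a → (1 + a) ^ suc m ≡ a ^ suc m + (Sum.sum (innerBinomialTerms m a) + 1)
  binomial-ends m a = begin
    (1 + a) ^ p                                            ≡⟨ ^≡^ (1 + a) p ⟨
    (1 + a) Exp.^ p                                        ≡⟨ Binomial.theorem p 1 a ⟩
    t zero + Sum.sum (tail t)                              ≡⟨ cong₂ _+_ first (Sum.sum-init-last (tail t)) ⟩
    a ^ p + (inner + last (tail t))                        ≡⟨ cong (λ z → a ^ p + (inner + z)) final ⟩
    a ^ p + (inner + 1)                                    ∎
    where
    open ≡-Reasoning
    p inner : ℕ
    p = suc m
    inner = Sum.sum (innerBinomialTerms m a)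
    t : Vector ℕ (suc p)
    t = Binomial.binomialTerm 1 a p
    first : t zero ≡ a ^ p
    first = trans (×≡* 1 _) (trans (*-identityˡ _) (trans (*-identityˡ _) (^≡^ a p)))
    final : last (tail t) ≡ 1
    final rewrite toℕ-fromℕ m | nCn≡1 p | n∸n≡0 m =
      trans (+-identityʳ _) (trans (*-identityʳ _) (trans (^≡^ 1 p) (^-zeroˡ p)))

  p∣innerBinomialTerms : ∀ {m} → Prime (suc m) → ∀ a i → suc m ∣ innerBinomialTerms m a i
  p∣innerBinomialTerms {m} p-prime a i =
    subst (suc m ∣_) (sym (×≡* (suc m C suc k) _)) (∣m⇒∣m*n _ (p∣pCk p-prime (s≤s z≤n) (s≤s k<m)))
    where
    k : ℕ
    k = toℕ (inject₁ i)
    k<m : k < m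
    k<m = subst (_< m) (sym (toℕ-inject₁ i)) (toℕ<n i)

  ^-odd : ∀ n k → n ^ (1 + 2 * k) ≡ n * (n * n) ^ k
  ^-odd n k = cong (n *_) (trans (sym (^-*-assoc n 2 k)) (cong (λ m → (n * m) ^ k) (*-identityʳ n)))

  module Congruence (d : ℕ) .{{_ : NonZero d}} where

    %-absorb : ∀ x {m} → d ∣ m → (x + m) % d ≡ x % d
    %-absorb x (divides-refl q) = [m+kn]%n≡m%n x q d

    +-cong-mod : ∀ {a b c e} → a % d ≡ b % d → c % d ≡ e % d → (a + c) % d ≡ (b + e) % d
    +-cong-mod {a} {b} {c} {e} a≡b c≡e = begin
      (a + c) % d          ≡⟨ %-distribˡ-+ a c d ⟩
      (a % d + c % d) % d  ≡⟨ cong₂ (λ x y → (x + y) % d) a≡b c≡e ⟩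
      (b % d + e % d) % d  ≡⟨ %-distribˡ-+ b e d ⟨
      (b + e) % d          ∎
      where open ≡-Reasoning

    *-cong-mod : ∀ {a b c e} → a % d ≡ b % d → c % d ≡ e % d → (a * c) % d ≡ (b * e) % d
    *-cong-mod {a} {b} {c} {e} a≡b c≡e = begin
      (a * c) % d              ≡⟨ %-distribˡ-* a c d ⟩
      (a % d * (c % d)) % d    ≡⟨ cong₂ (λ x y → (x * y) % d) a≡b c≡e ⟩
      (b % d * (e % d)) % d    ≡⟨ %-distribˡ-* b e d ⟨
      (b * e) % d              ∎
      where open ≡-Reasoning

    ^-cong-mod : ∀ {a b} → a % d ≡ b % d → ∀ k → a ^ k % d ≡ b ^ k % d
    ^-cong-mod a≡b zero    = refl
    ^-cong-mod a≡b (suc k) = *-cong-mod a≡b (^-cong-mod a≡b k)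

    x²≡1⇒x^odd≡x : ∀ {x} → x * x % d ≡ 1 % d → ∀ k → x ^ (1 + 2 * k) % d ≡ x % d
    x²≡1⇒x^odd≡x {x} x²≡1 k = begin
      x ^ (1 + 2 * k) % d    ≡⟨ cong (_% d) (^-odd x k) ⟩
      x * (x * x) ^ k % d    ≡⟨ *-cong-mod {a = x} refl (^-cong-mod x²≡1 k) ⟩
      x * 1 ^ k % d          ≡⟨ cong (λ y → x * y % d) (^-zeroˡ k) ⟩
      x * 1 % d              ≡⟨ cong (_% d) (*-identityʳ x) ⟩
      x % d                  ∎
      where open ≡-Reasoning

  [1+a]^p≡a^p+1 : ∀ {p} .{{_ : NonZero p}} → Prime p → ∀ a → (1 + a) ^ p % p ≡ (a ^ p + 1) % p
  [1+a]^p≡a^p+1 {suc m} p-prime a = begin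
    (1 + a) ^ p % p                                    ≡⟨ cong (_% p) (binomial-ends m a) ⟩
    (a ^ p + (Sum.sum (innerBinomialTerms m a) + 1)) % p ≡⟨ cong (_% p) (swap (a ^ p) _ 1) ⟩
    ((a ^ p + 1) + Sum.sum (innerBinomialTerms m a)) % p ≡⟨ %-absorb (a ^ p + 1) p∣inner ⟩
    (a ^ p + 1) % p                                    ∎
    where
    open ≡-Reasoning
    p : ℕ
    p = suc m
    open Congruence p
    p∣inner : p ∣ Sum.sum (innerBinomialTerms m a)
    p∣inner = ∣-sum (innerBinomialTerms m a) (p∣innerBinomialTerms p-prime a)
    swap : ∀ x y z → x + (y + z) ≡ (x + z) + y
    swap = solve-∀

  module _ {p} (p-prime : Prime p) where

    private instance
      p≢0 : NonZero p
      p≢0 = prime⇒nonZero p-prime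

    open Congruence p

    fermat : ∀ a → a ^ p % p ≡ a % p
    fermat zero    = cong (_% p) (0^n≡0 p)
      where
      0^n≡0 : ∀ n → .{{NonZero n}} → 0 ^ n ≡ 0
      0^n≡0 (suc n) = refl
    fermat (suc a) = begin
      (1 + a) ^ p % p  ≡⟨ [1+a]^p≡a^p+1 p-prime a ⟩
      (a ^ p + 1) % p  ≡⟨ +-cong-mod (fermat a) refl ⟩
      (a + 1) % p      ≡⟨ cong (_% p) (+-comm a 1) ⟩
      suc a % p        ∎
      where open ≡-Reasoning

    p∣x+1⇒x²≡1 : ∀ x → p ∣ x + 1 → x * x % p ≡ 1 % p
    p∣x+1⇒x²≡1 x p∣x+1 = begin
      x * x % p              ≡⟨ %-absorb (x * x) p∣x+1 ⟨
      (x * x + (x + 1)) % p  ≡⟨ cong (_% p) (rearrange x) ⟩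
      (1 + x * (x + 1)) % p  ≡⟨ %-absorb 1 (∣n⇒∣m*n x p∣x+1) ⟩
      1 % p                  ∎
      where
      open ≡-Reasoning
      rearrange : ∀ x → x * x + (x + 1) ≡ 1 + x * (x + 1)
      rearrange = solve-∀

    p≡3+[p/4]*4 : p % 4 ≡ 3 → p ≡ 3 + (p / 4) * 4
    p≡3+[p/4]*4 p%4≡3 = trans (m≡m%n+[m/n]*n p 4) (cong (_+ (p / 4) * 4) p%4≡3)

    p∣n²+1⇒p∣2n : p % 4 ≡ 3 → ∀ n → p ∣ n * n + 1 → p ∣ 2 * n
    p∣n²+1⇒p∣2n p%4≡3 n p∣n²+1 = m%n≡0⇒n∣m (2 * n) p (begin
      2 * n % p                    ≡⟨ cong (λ m → (n + m) % p) (+-identityʳ n) ⟩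
      (n + n) % p                  ≡⟨ +-cong-mod (fermat n) refl ⟨
      (n ^ p + n) % p              ≡⟨ cong (λ e → (n ^ e + n) % p) p≡1+2[1+2k] ⟩
      (n ^ (1 + 2 * (1 + 2 * k)) + n) % p
                                   ≡⟨ cong (λ m → (m + n) % p) (^-odd n (1 + 2 * k)) ⟩
      (n * (n * n) ^ (1 + 2 * k) + n) % p
                                   ≡⟨ +-cong-mod {c = n} (*-cong-mod {a = n} refl [n²]^odd≡n²) refl ⟩
      (n * (n * n) + n) % p        ≡⟨ cong (_% p) (distrib n (n * n)) ⟩
      n * (n * n + 1) % p          ≡⟨ n∣m⇒m%n≡0 _ p (∣n⇒∣m*n n p∣n²+1) ⟩
      0                            ∎)
      where
      open ≡-Reasoning
      k : ℕ
      k = p / 4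
      p≡1+2[1+2k] : p ≡ 1 + 2 * (1 + 2 * k)
      p≡1+2[1+2k] = trans (p≡3+[p/4]*4 p%4≡3) (reshape k)
        where
        reshape : ∀ k → 3 + k * 4 ≡ 1 + 2 * (1 + 2 * k)
        reshape = solve-∀
      [n²]^odd≡n² : (n * n) ^ (1 + 2 * k) % p ≡ n * n % p
      [n²]^odd≡n² = x²≡1⇒x^odd≡x (p∣x+1⇒x²≡1 (n * n) p∣n²+1) k
      distrib : ∀ n x → n * x + n ≡ n * (x + 1)
      distrib = solve-∀

    prime≡3[mod4]⇒∤n²+1 : p % 4 ≡ 3 → ∀ n → ¬ p ∣ n * n + 1
    prime≡3[mod4]⇒∤n²+1 p%4≡3 n p∣n²+1 with euclidsLemma 2 n p-prime (p∣n²+1⇒p∣2n p%4≡3 n p∣n²+1)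
    ... | inj₁ p∣2 = ≤⇒≯ (∣⇒≤ p∣2) (subst (3 ≤_) (sym (p≡3+[p/4]*4 p%4≡3)) (m≤m+n 3 _))
    ... | inj₂ p∣n = ¬prime[1] (subst Prime (∣1⇒≡1 (∣m+n∣m⇒∣n p∣n²+1 (∣m⇒∣m*n n p∣n))) p-prime)


open import Data.Integer
  using (ℤ; +_; -[1+_]; -_; _+_; _*_; _-_; 0ℤ; 1ℤ; -1ℤ; _<_; +<+; ∣_∣; ≢-nonZero)
open import Data.Integer.Properties
  using (_≟_; +◃n≡+n; pos-+; pos-*; abs-*; ∣-i∣≡∣i∣; ∣i∣≡0⇒i≡0; +-injective; *-zeroʳ; *-identityʳ;
         *-identityˡ; -1*i≡-i; +-comm; *-comm; +-identityʳ; *-cancelˡ-≡; i*j≡0⇒i≡0∨j≡0; <-cmp)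
open import Data.Integer.GCD using (gcd; gcd[i,j]∣i; gcd[i,j]∣j; gcd[i,j]≡0⇒j≡0)
open import Data.Integer.Tactic.RingSolver using (solve; solve-∀)
import Data.Integer.Divisibility.Signed as Signed
import Data.Nat as ℕ
import Data.Nat.Properties as ℕ
import Data.Nat.Divisibility as ℕ
import Data.Nat.GCD as ℕ
open import Data.Nat.Primality using (Prime; ¬prime[1])
open import Data.List.Base using (List; []; _∷_)
open import Data.Product using (∃; ∃₂; _×_; _,_; proj₁; proj₂)
open import Data.Sum using (_⊎_; inj₁; inj₂)
open import Data.Empty using (⊥-elim)
open import Function.Bundles using (_⇔_; mk⇔)
open import Relation.Nullary using (¬_; yes; no)
open import Relation.Binary.Definitions using (Tri; tri<; tri≈; tri>)
open import Relation.Binary.PropositionalEquality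

-- Integers: the obstruction mod p, Pell equations and gcds

x*x≡+∣x∣*∣x∣ : ∀ x → x * x ≡ + (∣ x ∣ ℕ.* ∣ x ∣)
x*x≡+∣x∣*∣x∣ (+ n)    = +◃n≡+n (n ℕ.* n)
x*x≡+∣x∣*∣x∣ -[1+ n ] = +◃n≡+n _

x²+bk≢-1 : ∀ {b} → HasPrime3mod4Divisor b → ∀ x k → x * x + b * k ≢ - 1ℤ
x²+bk≢-1 {b} (p , p-prime , p∣b , p%4≡3) x k x²+bk≡-1 =
  Fermat.prime≡3[mod4]⇒∤n²+1 p-prime p%4≡3 ∣ x ∣ (subst (p ℕ.∣_) (sym ∣x∣²+1≡∣b∣∣k∣) (ℕ.∣m⇒∣m*n ∣ k ∣ p∣b))
  where
  open ≡-Reasoning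
  x²+1≡-bk : x * x + 1ℤ ≡ - (b * k)
  x²+1≡-bk = begin
    x * x + 1ℤ                    ≡⟨ solve (x ∷ b ∷ k ∷ []) ⟩
    (x * x + b * k) + 1ℤ - b * k  ≡⟨ cong (λ z → z + 1ℤ - b * k) x²+bk≡-1 ⟩
    - 1ℤ + 1ℤ - b * k             ≡⟨ solve (b ∷ k ∷ []) ⟩
    - (b * k)                     ∎
  ∣x∣²+1≡∣b∣∣k∣ : ∣ x ∣ ℕ.* ∣ x ∣ ℕ.+ 1 ≡ ∣ b ∣ ℕ.* ∣ k ∣
  ∣x∣²+1≡∣b∣∣k∣ = begin
    ∣ x ∣ ℕ.* ∣ x ∣ ℕ.+ 1         ≡⟨ cong ∣_∣ (pos-+ (∣ x ∣ ℕ.* ∣ x ∣) 1) ⟩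
    ∣ + (∣ x ∣ ℕ.* ∣ x ∣) + 1ℤ ∣  ≡⟨ cong (λ z → ∣ z + 1ℤ ∣) (x*x≡+∣x∣*∣x∣ x) ⟨
    ∣ x * x + 1ℤ ∣               ≡⟨ cong ∣_∣ x²+1≡-bk ⟩
    ∣ - (b * k) ∣                ≡⟨ ∣-i∣≡∣i∣ (b * k) ⟩
    ∣ b * k ∣                    ≡⟨ abs-* b k ⟩
    ∣ b ∣ ℕ.* ∣ k ∣              ∎

HasPrime3mod4Divisor⇒≢1 : ∀ {b} → HasPrime3mod4Divisor b → b ≢ 1ℤ
HasPrime3mod4Divisor⇒≢1 (p , p-prime , p∣1 , _) refl = ¬prime[1] (subst Prime (ℕ.∣1⇒≡1 p∣1) p-prime)

m²+n²c≡1⇒m≡1∧n≡0 : ∀ {c} → 1 ℕ.< c → ∀ m n → m ℕ.* m ℕ.+ n ℕ.* n ℕ.* c ≡ 1 → m ≡ 1 × n ≡ 0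
m²+n²c≡1⇒m≡1∧n≡0 1<c m ℕ.zero    eq = ℕ.m*n≡1⇒m≡1 m m (trans (sym (ℕ.+-identityʳ _)) eq) , refl
m²+n²c≡1⇒m≡1∧n≡0 {c} 1<c m (ℕ.suc n) eq = ⊥-elim (ℕ.<⇒≱ 1<c c≤1)
  where
  c≤1 : c ℕ.≤ 1
  c≤1 = ℕ.≤-trans (ℕ.m≤n*m c (ℕ.suc n ℕ.* ℕ.suc n)) (ℕ.≤-trans (ℕ.m≤n+m _ (m ℕ.* m)) (ℕ.≤-reflexive eq))

∣i∣≡1⇒i≡±1 : ∀ {i} → ∣ i ∣ ≡ 1 → i ≡ 1ℤ ⊎ i ≡ -1ℤ
∣i∣≡1⇒i≡±1 { + _ }      refl = inj₁ refl
∣i∣≡1⇒i≡±1 { -[1+ _ ] } refl = inj₂ refl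

u²+v²b≡1⇒u≡±1∧v≡0 : ∀ {b u v} → 0ℤ < b → b ≢ 1ℤ → u * u + v * v * b ≡ 1ℤ → (u ≡ 1ℤ ⊎ u ≡ -1ℤ) × v ≡ 0ℤ
u²+v²b≡1⇒u≡±1∧v≡0 {+ c} {u} {v} (+<+ 0<c) b≢1 pell = ∣i∣≡1⇒i≡±1 (proj₁ ∣u∣≡1∧∣v∣≡0) , ∣i∣≡0⇒i≡0 (proj₂ ∣u∣≡1∧∣v∣≡0)
  where
  open ≡-Reasoning
  1<c : 1 ℕ.< c
  1<c = ℕ.≤∧≢⇒< 0<c (λ 1≡c → b≢1 (cong +_ (sym 1≡c)))
  pell-in-ℕ : + (∣ u ∣ ℕ.* ∣ u ∣ ℕ.+ ∣ v ∣ ℕ.* ∣ v ∣ ℕ.* c) ≡ + 1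
  pell-in-ℕ = begin
    + (∣ u ∣ ℕ.* ∣ u ∣ ℕ.+ ∣ v ∣ ℕ.* ∣ v ∣ ℕ.* c)    ≡⟨ pos-+ (∣ u ∣ ℕ.* ∣ u ∣) (∣ v ∣ ℕ.* ∣ v ∣ ℕ.* c) ⟩
    + (∣ u ∣ ℕ.* ∣ u ∣) + + (∣ v ∣ ℕ.* ∣ v ∣ ℕ.* c)  ≡⟨ cong (λ z → + (∣ u ∣ ℕ.* ∣ u ∣) + z) (pos-* (∣ v ∣ ℕ.* ∣ v ∣) c) ⟩
    + (∣ u ∣ ℕ.* ∣ u ∣) + + (∣ v ∣ ℕ.* ∣ v ∣) * + c  ≡⟨ cong₂ (λ x y → x + y * + c) (x*x≡+∣x∣*∣x∣ u) (x*x≡+∣x∣*∣x∣ v) ⟨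
    u * u + v * v * + c                             ≡⟨ pell ⟩
    + 1                                             ∎
  ∣u∣≡1∧∣v∣≡0 : ∣ u ∣ ≡ 1 × ∣ v ∣ ≡ 0
  ∣u∣≡1∧∣v∣≡0 = m²+n²c≡1⇒m≡1∧n≡0 1<c ∣ u ∣ ∣ v ∣ (+-injective pell-in-ℕ)

u≡-1∧pell⇒v≡0 : ∀ {b u v} → b ≢ 0ℤ → u ≡ -1ℤ → u * u + v * v * b ≡ 1ℤ → v ≡ 0ℤ
u≡-1∧pell⇒v≡0 {b} {u} {v} b≢0 refl pell with i*j≡0⇒i≡0∨j≡0 (v * v) v²b≡0
  where
  open ≡-Reasoning
  v²b≡0 : v * v * b ≡ 0ℤ
  v²b≡0 = begin
    v * v * b                     ≡⟨ solve (v ∷ b ∷ []) ⟩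
    (-1ℤ * -1ℤ + v * v * b) - 1ℤ  ≡⟨ cong (_- 1ℤ) pell ⟩
    1ℤ - 1ℤ                       ≡⟨⟩
    0ℤ                            ∎
... | inj₂ b≡0  = ⊥-elim (b≢0 b≡0)
... | inj₁ v²≡0 with i*j≡0⇒i≡0∨j≡0 v v²≡0
...   | inj₁ v≡0 = v≡0
...   | inj₂ v≡0 = v≡0

+∣i∣≡±i : ∀ i → ∃ λ s → + ∣ i ∣ ≡ s * i
+∣i∣≡±i (+ n)    = 1ℤ , sym (*-identityˡ (+ n))
+∣i∣≡±i -[1+ n ] = -1ℤ , sym (-1*i≡-i -[1+ n ])

bézout-ℕ⇒ℤ : ∀ {d m n} x y → d ℕ.+ y ℕ.* n ≡ x ℕ.* m → + d + + y * + n ≡ + x * + m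
bézout-ℕ⇒ℤ {d} {m} {n} x y eq = begin
  + d + + y * + n    ≡⟨ cong (λ z → + d + z) (pos-* y n) ⟨
  + d + + (y ℕ.* n)  ≡⟨ pos-+ d (y ℕ.* n) ⟨
  + (d ℕ.+ y ℕ.* n)  ≡⟨ cong +_ eq ⟩
  + (x ℕ.* m)        ≡⟨ pos-* x m ⟩
  + x * + m          ∎
  where open ≡-Reasoning

bézout-combine : ∀ {d m n} x y s t i j → d + y * n ≡ x * m → m ≡ s * i → n ≡ t * j →
                 d ≡ (x * s) * i + (- (y * t)) * j
bézout-combine {d} {m} {n} x y s t i j eq m≡si n≡tj = begin
  d                              ≡⟨ solve (d ∷ y ∷ n ∷ []) ⟩
  (d + y * n) - y * n            ≡⟨ cong (_- y * n) eq ⟩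
  x * m - y * n                  ≡⟨ cong₂ (λ m n → x * m - y * n) m≡si n≡tj ⟩
  x * (s * i) - y * (t * j)      ≡⟨ solve (x ∷ s ∷ i ∷ y ∷ t ∷ j ∷ []) ⟩
  (x * s) * i + (- (y * t)) * j  ∎
  where open ≡-Reasoning

gcd-bézout : ∀ i j → ∃₂ λ a c → gcd i j ≡ a * i + c * j
gcd-bézout i j with ℕ.Bézout.identity (ℕ.gcd-GCD ∣ i ∣ ∣ j ∣) | +∣i∣≡±i i | +∣i∣≡±i j
... | ℕ.Bézout.+- x y eq | s , m≡si | t , n≡tj =
  + x * s , - (+ y * t) , bézout-combine (+ x) (+ y) s t i j (bézout-ℕ⇒ℤ x y eq) m≡si n≡tj
... | ℕ.Bézout.-+ x y eq | s , m≡si | t , n≡tj =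
  - (+ x * s) , + y * t ,
  trans (bézout-combine (+ y) (+ x) t s j i (bézout-ℕ⇒ℤ y x eq) n≡tj m≡si) (+-comm ((+ y * t) * j) (- (+ x * s) * i))

gcd-quotients : ∀ i j → ∃₂ λ qᵢ qⱼ → i ≡ gcd i j * qᵢ × j ≡ gcd i j * qⱼ
gcd-quotients i j = quotient gᵢ , quotient gⱼ ,
  trans (equality gᵢ) (*-comm (quotient gᵢ) (gcd i j)) , trans (equality gⱼ) (*-comm (quotient gⱼ) (gcd i j))
  where
  open Signed._∣_
  gᵢ : gcd i j Signed.∣ i
  gᵢ = Signed.∣ᵤ⇒∣ {gcd i j} {i} (gcd[i,j]∣i i j)
  gⱼ : gcd i j Signed.∣ j
  gⱼ = Signed.∣ᵤ⇒∣ {gcd i j} {j} (gcd[i,j]∣j i j)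

a+b≡0⇒a≡-b : ∀ {a b} → a + b ≡ 0ℤ → a ≡ - b
a+b≡0⇒a≡-b {a} {b} a+b≡0 = begin
  a            ≡⟨ solve (a ∷ b ∷ []) ⟩
  a + b - b    ≡⟨ cong (_- b) a+b≡0 ⟩
  0ℤ - b       ≡⟨ solve (b ∷ []) ⟩
  - b          ∎
  where open ≡-Reasoning

a+b≡c⇒a≡c-b : ∀ {a b c} → a + b ≡ c → a ≡ c - b
a+b≡c⇒a≡c-b {a} {b} {c} a+b≡c = begin
  a            ≡⟨ solve (a ∷ b ∷ []) ⟩
  a + b - b    ≡⟨ cong (_- b) a+b≡c ⟩
  c - b        ∎
  where open ≡-Reasoning

gcd[v,u+1]≢0 : ∀ {u v} → u ≢ - 1ℤ → gcd v (u + 1ℤ) ≢ 0ℤ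
gcd[v,u+1]≢0 {u} {v} u≢-1 g≡0 = u≢-1 (a+b≡0⇒a≡-b (gcd[i,j]≡0⇒j≡0 {v} g≡0))

-x≡x⇒x≡0 : ∀ {x} → - x ≡ x → x ≡ 0ℤ
-x≡x⇒x≡0 {x} -x≡x with i*j≡0⇒i≡0∨j≡0 (+ 2) 2x≡0
  where
  open ≡-Reasoning
  2x≡0 : + 2 * x ≡ 0ℤ
  2x≡0 = begin
    + 2 * x    ≡⟨ solve (x ∷ []) ⟩
    x - - x    ≡⟨ cong (λ z → x - z) -x≡x ⟩
    x - x      ≡⟨ solve (x ∷ []) ⟩
    0ℤ         ∎
... | inj₂ x≡0 = x≡0

-y≡uy-vx⇒vx≡[u+1]y : ∀ {u v x y} → - y ≡ u * y - v * x → v * x ≡ (u + 1ℤ) * y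
-y≡uy-vx⇒vx≡[u+1]y {u} {v} {x} {y} -y≡uy-vx = begin
  v * x                              ≡⟨ solve (u ∷ v ∷ x ∷ y ∷ []) ⟩
  (u + 1ℤ) * y - (u * y - v * x + y) ≡⟨ cong (λ z → (u + 1ℤ) * y - (z + y)) -y≡uy-vx ⟨
  (u + 1ℤ) * y - (- y + y)           ≡⟨ solve (u ∷ y ∷ []) ⟩
  (u + 1ℤ) * y                       ∎
  where open ≡-Reasoning

v*x≡w*y⇒multiples : ∀ {g a c α β v w x y} → g ≢ 0ℤ → w ≡ g * α → v ≡ g * β → g ≡ a * v + c * w →
                    v * x ≡ w * y → x ≡ α * (a * y + c * x) × y ≡ β * (a * y + c * x)
v*x≡w*y⇒multiples {g} {a} {c} {α} {β} {v} {w} {x} {y} g≢0 w≡gα v≡gβ g≡av+cw vx≡wy =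
  *-cancelˡ-≡ g x (α * (a * y + c * x)) {{≢-nonZero g≢0}} gx≡gαt ,
  *-cancelˡ-≡ g y (β * (a * y + c * x)) {{≢-nonZero g≢0}} gy≡gβt
  where
  open ≡-Reasoning
  gx≡gαt : g * x ≡ g * (α * (a * y + c * x))
  gx≡gαt = begin
    g * x                        ≡⟨ cong (_* x) g≡av+cw ⟩
    (a * v + c * w) * x          ≡⟨ solve (a ∷ v ∷ c ∷ w ∷ x ∷ []) ⟩
    a * (v * x) + c * w * x      ≡⟨ cong (λ z → a * z + c * w * x) vx≡wy ⟩
    a * (w * y) + c * w * x      ≡⟨ solve (a ∷ w ∷ y ∷ c ∷ x ∷ []) ⟩
    w * (a * y + c * x)          ≡⟨ cong (_* (a * y + c * x)) w≡gα ⟩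
    g * α * (a * y + c * x)      ≡⟨ solve (g ∷ α ∷ a ∷ y ∷ c ∷ x ∷ []) ⟩
    g * (α * (a * y + c * x))    ∎
  gy≡gβt : g * y ≡ g * (β * (a * y + c * x))
  gy≡gβt = begin
    g * y                        ≡⟨ cong (_* y) g≡av+cw ⟩
    (a * v + c * w) * y          ≡⟨ solve (a ∷ v ∷ c ∷ w ∷ y ∷ []) ⟩
    a * v * y + c * (w * y)      ≡⟨ cong (λ z → a * v * y + c * z) vx≡wy ⟨
    a * v * y + c * (v * x)      ≡⟨ solve (a ∷ v ∷ y ∷ c ∷ x ∷ []) ⟩
    v * (a * y + c * x)          ≡⟨ cong (_* (a * y + c * x)) v≡gβ ⟩
    g * β * (a * y + c * x)      ≡⟨ solve (g ∷ β ∷ a ∷ y ∷ c ∷ x ∷ []) ⟩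
    g * (β * (a * y + c * x))    ∎

pell-family-condition : ∀ {b g α β u v x₁ x₂ x₃ y₁ y₂ y₃ t₂ t₃} → u + 1ℤ ≡ g * α → v ≡ g * β →
  x₂ ≡ α * t₂ × y₂ ≡ β * t₂ → x₃ ≡ α * t₃ × y₃ ≡ β * t₃ → u * u + v * v * b ≡ 1ℤ →
  x₁ * x₁ + x₂ * x₃ + b * (y₁ * y₁ + y₂ * y₃) ≡ - 1ℤ →
  g * g * (x₁ * x₁ + b * (y₁ * y₁) + 1ℤ) + + 2 * t₂ * t₃ * (1ℤ + u) ≡ 0ℤ
pell-family-condition {b} {g} {α} {β} {u} {_} {x₁} {_} {_} {y₁} {_} {_} {t₂} {t₃}
  u+1≡gα refl (refl , refl) (refl , refl) pell e₁₁ = begin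
  g * g * (x₁ * x₁ + b * (y₁ * y₁) + 1ℤ) + + 2 * t₂ * t₃ * (1ℤ + u)
    ≡⟨ solve (g ∷ x₁ ∷ b ∷ y₁ ∷ t₂ ∷ t₃ ∷ u ∷ α ∷ β ∷ []) ⟩
  g * g * (x₁ * x₁ + α * t₂ * (α * t₃) + b * (y₁ * y₁ + β * t₂ * (β * t₃)) + 1ℤ)
    - t₂ * t₃ * ((g * α) * (g * α) + (g * β) * (g * β) * b - + 2 * (1ℤ + u))
    ≡⟨ cong₂ (λ e w → g * g * (e + 1ℤ) - t₂ * t₃ * (w * w + (g * β) * (g * β) * b - + 2 * (1ℤ + u)))
             e₁₁ (sym u+1≡gα) ⟩
  g * g * (- 1ℤ + 1ℤ) - t₂ * t₃ * ((u + 1ℤ) * (u + 1ℤ) + (g * β) * (g * β) * b - + 2 * (1ℤ + u))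
    ≡⟨ solve (g ∷ t₂ ∷ t₃ ∷ u ∷ β ∷ b ∷ []) ⟩
  - (t₂ * t₃ * (u * u + (g * β) * (g * β) * b - 1ℤ))
    ≡⟨ cong (λ z → - (t₂ * t₃ * (z - 1ℤ))) pell ⟩
  - (t₂ * t₃ * (1ℤ - 1ℤ))
    ≡⟨ solve (t₂ ∷ t₃ ∷ []) ⟩
  0ℤ ∎
  where open ≡-Reasoning

-- 2 × 2 integer matrices

0ᴹ : M2
0ᴹ = mat 0ℤ 0ℤ 0ℤ 0ℤ

_-ᴹ_ : M2 → M2 → M2
A -ᴹ B = A +ᴹ (-ᴹ B)

⁅_,_⁆ : M2 → M2 → M2
⁅ A , B ⁆ = (A *ᴹ B) -ᴹ (B *ᴹ A)

tr det : M2 → ℤ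
tr  (mat a _ _ d) = a + d
det (mat a b c d) = a * d - b * c

adj : M2 → M2
adj (mat a b c d) = mat d (- b) (- c) a

-- For s² = −b these are the two parts of det (X + sY) = detRe b X Y + s · detIm X Y.
detRe : ℤ → M2 → M2 → ℤ
detRe b X Y = det X - b * det Y

detIm : M2 → M2 → ℤ
detIm (mat a b c d) (mat a′ b′ c′ d′) = a * d′ + d * a′ - b * c′ - c * b′

-- Identities between matrix expressions are proved entrywise below, with the entries written out so
-- that the ring solver sees integer polynomials rather than projections of unevaluated matrices.
mat≡ : ∀ {a b c d a′ b′ c′ d′} → a ≡ a′ × b ≡ b′ × c ≡ c′ × d ≡ d′ → mat a b c d ≡ mat a′ b′ c′ d′
mat≡ (refl , refl , refl , refl) = refl

k·A≡0⇒A≡0 : ∀ {k A} → k ≢ 0ℤ → k ·ᴹ A ≡ 0ᴹ → A ≡ 0ᴹ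
k·A≡0⇒A≡0 {k} {mat _ _ _ _} k≢0 kA≡0 =
  mat≡ (entry (cong a₁₁ kA≡0) , entry (cong a₁₂ kA≡0) , entry (cong a₂₁ kA≡0) , entry (cong a₂₂ kA≡0))
  where
  entry : ∀ {x} → k * x ≡ 0ℤ → x ≡ 0ℤ
  entry kx≡0 with i*j≡0⇒i≡0∨j≡0 k kx≡0
  ... | inj₁ k≡0 = ⊥-elim (k≢0 k≡0)
  ... | inj₂ x≡0 = x≡0

A+B≡0⇒A≡-B : ∀ {A B} → A +ᴹ B ≡ 0ᴹ → A ≡ -ᴹ B
A+B≡0⇒A≡-B {mat _ _ _ _} {mat _ _ _ _} A+B≡0 = mat≡
  (a+b≡0⇒a≡-b (cong a₁₁ A+B≡0) , a+b≡0⇒a≡-b (cong a₁₂ A+B≡0) ,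
   a+b≡0⇒a≡-b (cong a₂₁ A+B≡0) , a+b≡0⇒a≡-b (cong a₂₂ A+B≡0))

tr≡0⇒traceless : ∀ {A} → tr A ≡ 0ℤ → A ≡ mat (a₁₁ A) (a₁₂ A) (a₂₁ A) (- a₁₁ A)
tr≡0⇒traceless {mat a _ _ d} a+d≡0 = mat≡ (refl , refl , refl , a+b≡0⇒a≡-b (trans (+-comm d a) a+d≡0))

adj≡-A⇒traceless : ∀ {A} → adj A ≡ -ᴹ A → A ≡ mat (a₁₁ A) (a₁₂ A) (a₂₁ A) (- a₁₁ A)
adj≡-A⇒traceless {mat _ _ _ _} adjA≡-A = mat≡ (refl , refl , refl , cong a₁₁ adjA≡-A)

adj≡A⇒scalar : ∀ {A} → adj A ≡ A → A ≡ a₁₁ A ·ᴹ I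
adj≡A⇒scalar {mat a _ _ _} adjA≡A = mat≡
  ( sym (*-identityʳ a)
  , trans (-x≡x⇒x≡0 (cong a₁₂ adjA≡A)) (sym (*-zeroʳ a))
  , trans (-x≡x⇒x≡0 (cong a₂₁ adjA≡A)) (sym (*-zeroʳ a))
  , trans (cong a₁₁ adjA≡A) (sym (*-identityʳ a)) )

sq-traceless : ∀ t₁ t₂ t₃ → sq (mat t₁ t₂ t₃ (- t₁)) ≡ (t₁ * t₁ + t₂ * t₃) ·ᴹ I
sq-traceless t₁ t₂ t₃ = mat≡ (solve vs , solve vs , solve vs , solve vs)
  where vs = t₁ ∷ t₂ ∷ t₃ ∷ []

sq-scalar : ∀ t → sq (t ·ᴹ I) ≡ (t * t) ·ᴹ I
sq-scalar t = mat≡ entries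
  where
  entries : (t * 1ℤ) * (t * 1ℤ) + (t * 0ℤ) * (t * 0ℤ) ≡ t * t * 1ℤ
          × (t * 1ℤ) * (t * 0ℤ) + (t * 0ℤ) * (t * 1ℤ) ≡ t * t * 0ℤ
          × (t * 0ℤ) * (t * 1ℤ) + (t * 1ℤ) * (t * 0ℤ) ≡ t * t * 0ℤ
          × (t * 0ℤ) * (t * 0ℤ) + (t * 1ℤ) * (t * 1ℤ) ≡ t * t * 1ℤ
  entries = solve (t ∷ []) , solve (t ∷ []) , solve (t ∷ []) , solve (t ∷ [])

scalar-solution : ∀ b X Y k m → sq X ≡ k ·ᴹ I → sq Y ≡ m ·ᴹ I → k + b * m ≡ - 1ℤ →
                  sq X +ᴹ (b ·ᴹ sq Y) ≡ -ᴹ I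
scalar-solution b X Y k m X²≡kI Y²≡mI k+bm≡-1 = begin
  sq X +ᴹ (b ·ᴹ sq Y)          ≡⟨ cong₂ (λ A B → A +ᴹ (b ·ᴹ B)) X²≡kI Y²≡mI ⟩
  (k ·ᴹ I) +ᴹ (b ·ᴹ (m ·ᴹ I))  ≡⟨ mat≡ entries ⟩
  (k + b * m) ·ᴹ I             ≡⟨ cong (_·ᴹ I) k+bm≡-1 ⟩
  -ᴹ I                         ∎
  where
  open ≡-Reasoning
  vs : List ℤ
  vs = k ∷ b ∷ m ∷ []
  entries : k * 1ℤ + b * (m * 1ℤ) ≡ (k + b * m) * 1ℤ × k * 0ℤ + b * (m * 0ℤ) ≡ (k + b * m) * 0ℤ
          × k * 0ℤ + b * (m * 0ℤ) ≡ (k + b * m) * 0ℤ × k * 1ℤ + b * (m * 1ℤ) ≡ (k + b * m) * 1ℤ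
  entries = solve vs , solve vs , solve vs , solve vs

⁅-I,A⁆≡0 : ∀ A → ⁅ -ᴹ I , A ⁆ ≡ 0ᴹ
⁅-I,A⁆≡0 (mat a₁ a₂ a₃ a₄) = mat≡ entries
  where
  vs : List ℤ
  vs = a₁ ∷ a₂ ∷ a₃ ∷ a₄ ∷ []
  entries : - 1ℤ * a₁ + 0ℤ * a₃ - (a₁ * - 1ℤ + a₂ * 0ℤ) ≡ 0ℤ × - 1ℤ * a₂ + 0ℤ * a₄ - (a₁ * 0ℤ + a₂ * - 1ℤ) ≡ 0ℤ
          × 0ℤ * a₁ + - 1ℤ * a₃ - (a₃ * - 1ℤ + a₄ * 0ℤ) ≡ 0ℤ × 0ℤ * a₂ + - 1ℤ * a₄ - (a₃ * 0ℤ + a₄ * - 1ℤ) ≡ 0ℤ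
  entries = solve vs , solve vs , solve vs , solve vs

⁅A,-I⁆≡0 : ∀ A → ⁅ A , -ᴹ I ⁆ ≡ 0ᴹ
⁅A,-I⁆≡0 (mat a₁ a₂ a₃ a₄) = mat≡ entries
  where
  vs : List ℤ
  vs = a₁ ∷ a₂ ∷ a₃ ∷ a₄ ∷ []
  entries : a₁ * - 1ℤ + a₂ * 0ℤ - (- 1ℤ * a₁ + 0ℤ * a₃) ≡ 0ℤ × a₁ * 0ℤ + a₂ * - 1ℤ - (- 1ℤ * a₂ + 0ℤ * a₄) ≡ 0ℤ
          × a₃ * - 1ℤ + a₄ * 0ℤ - (0ℤ * a₁ + - 1ℤ * a₃) ≡ 0ℤ × a₃ * 0ℤ + a₄ * - 1ℤ - (0ℤ * a₂ + - 1ℤ * a₄) ≡ 0ℤ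
  entries = solve vs , solve vs , solve vs , solve vs

⁅X²+bY²,Y⁆≡trX·⁅X,Y⁆ : ∀ b X Y → ⁅ sq X +ᴹ (b ·ᴹ sq Y) , Y ⁆ ≡ tr X ·ᴹ ⁅ X , Y ⁆
⁅X²+bY²,Y⁆≡trX·⁅X,Y⁆ b (mat x₁ x₂ x₃ x₄) (mat y₁ y₂ y₃ y₄) = mat≡ entries
  where
  vs : List ℤ
  vs = b ∷ x₁ ∷ x₂ ∷ x₃ ∷ x₄ ∷ y₁ ∷ y₂ ∷ y₃ ∷ y₄ ∷ []
  entries : let s₁₁ = x₁ * x₁ + x₂ * x₃ + b * (y₁ * y₁ + y₂ * y₃)
                s₁₂ = x₁ * x₂ + x₂ * x₄ + b * (y₁ * y₂ + y₂ * y₄)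
                s₂₁ = x₃ * x₁ + x₄ * x₃ + b * (y₃ * y₁ + y₄ * y₃)
                s₂₂ = x₃ * x₂ + x₄ * x₄ + b * (y₃ * y₂ + y₄ * y₄)
                τ   = x₁ + x₄
            in s₁₁ * y₁ + s₁₂ * y₃ - (y₁ * s₁₁ + y₂ * s₂₁) ≡ τ * (x₁ * y₁ + x₂ * y₃ - (y₁ * x₁ + y₂ * x₃))
             × s₁₁ * y₂ + s₁₂ * y₄ - (y₁ * s₁₂ + y₂ * s₂₂) ≡ τ * (x₁ * y₂ + x₂ * y₄ - (y₁ * x₂ + y₂ * x₄))
             × s₂₁ * y₁ + s₂₂ * y₃ - (y₃ * s₁₁ + y₄ * s₂₁) ≡ τ * (x₃ * y₁ + x₄ * y₃ - (y₃ * x₁ + y₄ * x₃))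
             × s₂₁ * y₂ + s₂₂ * y₄ - (y₃ * s₁₂ + y₄ * s₂₂) ≡ τ * (x₃ * y₂ + x₄ * y₄ - (y₃ * x₂ + y₄ * x₄))
  entries = solve vs , solve vs , solve vs , solve vs

⁅X,X²+bY²⁆≡b·trY·⁅X,Y⁆ : ∀ b X Y → ⁅ X , sq X +ᴹ (b ·ᴹ sq Y) ⁆ ≡ (b * tr Y) ·ᴹ ⁅ X , Y ⁆
⁅X,X²+bY²⁆≡b·trY·⁅X,Y⁆ b (mat x₁ x₂ x₃ x₄) (mat y₁ y₂ y₃ y₄) = mat≡ entries
  where
  vs : List ℤ
  vs = b ∷ x₁ ∷ x₂ ∷ x₃ ∷ x₄ ∷ y₁ ∷ y₂ ∷ y₃ ∷ y₄ ∷ []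
  entries : let s₁₁ = x₁ * x₁ + x₂ * x₃ + b * (y₁ * y₁ + y₂ * y₃)
                s₁₂ = x₁ * x₂ + x₂ * x₄ + b * (y₁ * y₂ + y₂ * y₄)
                s₂₁ = x₃ * x₁ + x₄ * x₃ + b * (y₃ * y₁ + y₄ * y₃)
                s₂₂ = x₃ * x₂ + x₄ * x₄ + b * (y₃ * y₂ + y₄ * y₄)
                bσ  = b * (y₁ + y₄)
            in x₁ * s₁₁ + x₂ * s₂₁ - (s₁₁ * x₁ + s₁₂ * x₃) ≡ bσ * (x₁ * y₁ + x₂ * y₃ - (y₁ * x₁ + y₂ * x₃))
             × x₁ * s₁₂ + x₂ * s₂₂ - (s₁₁ * x₂ + s₁₂ * x₄) ≡ bσ * (x₁ * y₂ + x₂ * y₄ - (y₁ * x₂ + y₂ * x₄))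
             × x₃ * s₁₁ + x₄ * s₂₁ - (s₂₁ * x₁ + s₂₂ * x₃) ≡ bσ * (x₃ * y₁ + x₄ * y₃ - (y₃ * x₁ + y₄ * x₃))
             × x₃ * s₁₂ + x₄ * s₂₂ - (s₂₁ * x₂ + s₂₂ * x₄) ≡ bσ * (x₃ * y₂ + x₄ * y₄ - (y₃ * x₂ + y₄ * x₄))
  entries = solve vs , solve vs , solve vs , solve vs

-- With M = X + sY, M̄ = X − sY and s² = −b one has M·M̄ = X² + bY² + s⁅Y,X⁆ and det M = u + sv: the
-- first two identities are the two parts of adj M·M·M̄ = det M·M̄, the third is det M·det M̄ = det (M·M̄).
commuting-identities : ∀ b X Y →
  let E = (sq X +ᴹ (b ·ᴹ sq Y)) +ᴹ I ; C = ⁅ X , Y ⁆ ; u = detRe b X Y ; v = detIm X Y in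
    adj X ≡ (-ᴹ ((u ·ᴹ X) +ᴹ ((v * b) ·ᴹ Y))) +ᴹ ((adj X *ᴹ E) +ᴹ ((b ·ᴹ adj Y) *ᴹ C))
  × adj Y ≡ ((u ·ᴹ Y) -ᴹ (v ·ᴹ X)) +ᴹ ((adj Y *ᴹ E) +ᴹ ((-ᴹ adj X) *ᴹ C))
  × u * u + v * v * b ≡ 1ℤ + (det E - tr E) - b * det C
commuting-identities b (mat x₁ x₂ x₃ x₄) (mat y₁ y₂ y₃ y₄) =
  mat≡ (proj₁ entries) , mat≡ (proj₁ (proj₂ entries)) , proj₂ (proj₂ entries)
  where
  vs : List ℤ
  vs = b ∷ x₁ ∷ x₂ ∷ x₃ ∷ x₄ ∷ y₁ ∷ y₂ ∷ y₃ ∷ y₄ ∷ []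
  entries :
    let u   = x₁ * x₄ - x₂ * x₃ - b * (y₁ * y₄ - y₂ * y₃)
        v   = x₁ * y₄ + x₄ * y₁ - x₂ * y₃ - x₃ * y₂
        e₁₁ = x₁ * x₁ + x₂ * x₃ + b * (y₁ * y₁ + y₂ * y₃) + 1ℤ
        e₁₂ = x₁ * x₂ + x₂ * x₄ + b * (y₁ * y₂ + y₂ * y₄) + 0ℤ
        e₂₁ = x₃ * x₁ + x₄ * x₃ + b * (y₃ * y₁ + y₄ * y₃) + 0ℤ
        e₂₂ = x₃ * x₂ + x₄ * x₄ + b * (y₃ * y₂ + y₄ * y₄) + 1ℤ
        c₁₁ = x₁ * y₁ + x₂ * y₃ - (y₁ * x₁ + y₂ * x₃)
        c₁₂ = x₁ * y₂ + x₂ * y₄ - (y₁ * x₂ + y₂ * x₄)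
        c₂₁ = x₃ * y₁ + x₄ * y₃ - (y₃ * x₁ + y₄ * x₃)
        c₂₂ = x₃ * y₂ + x₄ * y₄ - (y₃ * x₂ + y₄ * x₄)
    in ( x₄   ≡ - (u * x₁ + v * b * y₁) + ((x₄ * e₁₁ + - x₂ * e₂₁) + (b * y₄ * c₁₁ + b * - y₂ * c₂₁))
       × - x₂ ≡ - (u * x₂ + v * b * y₂) + ((x₄ * e₁₂ + - x₂ * e₂₂) + (b * y₄ * c₁₂ + b * - y₂ * c₂₂))
       × - x₃ ≡ - (u * x₃ + v * b * y₃) + ((- x₃ * e₁₁ + x₁ * e₂₁) + (b * - y₃ * c₁₁ + b * y₁ * c₂₁))
       × x₁   ≡ - (u * x₄ + v * b * y₄) + ((- x₃ * e₁₂ + x₁ * e₂₂) + (b * - y₃ * c₁₂ + b * y₁ * c₂₂)))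
     × ( y₄   ≡ u * y₁ - v * x₁ + ((y₄ * e₁₁ + - y₂ * e₂₁) + (- x₄ * c₁₁ + - - x₂ * c₂₁))
       × - y₂ ≡ u * y₂ - v * x₂ + ((y₄ * e₁₂ + - y₂ * e₂₂) + (- x₄ * c₁₂ + - - x₂ * c₂₂))
       × - y₃ ≡ u * y₃ - v * x₃ + ((- y₃ * e₁₁ + y₁ * e₂₁) + (- - x₃ * c₁₁ + - x₁ * c₂₁))
       × y₁   ≡ u * y₄ - v * x₄ + ((- y₃ * e₁₂ + y₁ * e₂₂) + (- - x₃ * c₁₂ + - x₁ * c₂₂)))
     × u * u + v * v * b ≡ 1ℤ + ((e₁₁ * e₂₂ - e₁₂ * e₂₁) - (e₁₁ + e₂₂)) - b * (c₁₁ * c₂₂ - c₁₂ * c₂₁)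
  entries = (solve vs , solve vs , solve vs , solve vs) , (solve vs , solve vs , solve vs , solve vs) , solve vs

R+[A·P+B·Q]≡R : ∀ R A B {P Q} → P ≡ 0ᴹ → Q ≡ 0ᴹ → R +ᴹ ((A *ᴹ P) +ᴹ (B *ᴹ Q)) ≡ R
R+[A·P+B·Q]≡R (mat r₁ r₂ r₃ r₄) (mat a₁ a₂ a₃ a₄) (mat b₁ b₂ b₃ b₄) refl refl = mat≡
  (vanish r₁ a₁ a₂ b₁ b₂ , vanish r₂ a₁ a₂ b₁ b₂ , vanish r₃ a₃ a₄ b₃ b₄ , vanish r₄ a₃ a₄ b₃ b₄)
  where
  vanish : ∀ r a a′ b b′ → r + ((a * 0ℤ + a′ * 0ℤ) + (b * 0ℤ + b′ * 0ℤ)) ≡ r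
  vanish = solve-∀

-[-1·X+0·Y]≡X : ∀ X Y → -ᴹ (((- 1ℤ) ·ᴹ X) +ᴹ (0ℤ ·ᴹ Y)) ≡ X
-[-1·X+0·Y]≡X (mat x₁ x₂ x₃ x₄) (mat y₁ y₂ y₃ y₄) = mat≡ (entry x₁ y₁ , entry x₂ y₂ , entry x₃ y₃ , entry x₄ y₄)
  where
  entry : ∀ x y → - (- 1ℤ * x + 0ℤ * y) ≡ x
  entry = solve-∀

-[1·X+0·Y]≡-X : ∀ X Y → -ᴹ ((1ℤ ·ᴹ X) +ᴹ (0ℤ ·ᴹ Y)) ≡ -ᴹ X
-[1·X+0·Y]≡-X (mat x₁ x₂ x₃ x₄) (mat y₁ y₂ y₃ y₄) = mat≡ (entry x₁ y₁ , entry x₂ y₂ , entry x₃ y₃ , entry x₄ y₄)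
  where
  entry : ∀ x y → - (1ℤ * x + 0ℤ * y) ≡ - x
  entry = solve-∀

1·Y-0·X≡Y : ∀ X Y → (1ℤ ·ᴹ Y) -ᴹ (0ℤ ·ᴹ X) ≡ Y
1·Y-0·X≡Y (mat x₁ x₂ x₃ x₄) (mat y₁ y₂ y₃ y₄) = mat≡ (entry x₁ y₁ , entry x₂ y₂ , entry x₃ y₃ , entry x₄ y₄)
  where
  entry : ∀ x y → 1ℤ * y - 0ℤ * x ≡ y
  entry = solve-∀

pell-family-defect : ∀ b g α β t₁ t₂ t₃ t₄ → let u = g * α - 1ℤ ; v = g * β in
  (g * g) ·ᴹ ((sq (mat t₁ (α * t₂) (α * t₃) (- (u * t₁ + v * b * t₄)))
               +ᴹ (b ·ᴹ sq (mat t₄ (β * t₂) (β * t₃) (u * t₄ - v * t₁)))) +ᴹ I)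
  ≡ ((g * g * (t₁ * t₁ + b * (t₄ * t₄) + 1ℤ) + + 2 * t₂ * t₃ * (1ℤ + u)) ·ᴹ I)
    +ᴹ ((u * u + v * v * b - 1ℤ)
        ·ᴹ mat (t₂ * t₃) (- (g * t₁ * t₂)) (- (g * t₁ * t₃)) (t₂ * t₃ + g * g * (t₁ * t₁ + b * (t₄ * t₄))))
pell-family-defect b g α β t₁ t₂ t₃ t₄ = mat≡ entries
  where
  vs : List ℤ
  vs = b ∷ g ∷ α ∷ β ∷ t₁ ∷ t₂ ∷ t₃ ∷ t₄ ∷ []
  entries :
    let u  = g * α - 1ℤ ; v = g * β
        x₂ = α * t₂ ; x₃ = α * t₃ ; x₄ = - (u * t₁ + v * b * t₄)
        y₂ = β * t₂ ; y₃ = β * t₃ ; y₄ = u * t₄ - v * t₁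
        c  = g * g * (t₁ * t₁ + b * (t₄ * t₄) + 1ℤ) + + 2 * t₂ * t₃ * (1ℤ + u)
        p  = u * u + v * v * b - 1ℤ
    in g * g * (t₁ * t₁ + x₂ * x₃ + b * (t₄ * t₄ + y₂ * y₃) + 1ℤ) ≡ c * 1ℤ + p * (t₂ * t₃)
     × g * g * (t₁ * x₂ + x₂ * x₄ + b * (t₄ * y₂ + y₂ * y₄) + 0ℤ) ≡ c * 0ℤ + p * - (g * t₁ * t₂)
     × g * g * (x₃ * t₁ + x₄ * x₃ + b * (y₃ * t₄ + y₄ * y₃) + 0ℤ) ≡ c * 0ℤ + p * - (g * t₁ * t₃)
     × g * g * (x₃ * x₂ + x₄ * x₄ + b * (y₃ * y₂ + y₄ * y₄) + 1ℤ)
         ≡ c * 1ℤ + p * (t₂ * t₃ + g * g * (t₁ * t₁ + b * (t₄ * t₄)))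
  entries = solve vs , solve vs , solve vs , solve vs

pell-family-solution : ∀ {b g α β u v t₁ t₂ t₃ t₄} → g ≢ 0ℤ → u + 1ℤ ≡ g * α → v ≡ g * β →
  u * u + v * v * b ≡ 1ℤ → g * g * (t₁ * t₁ + b * (t₄ * t₄) + 1ℤ) + + 2 * t₂ * t₃ * (1ℤ + u) ≡ 0ℤ →
  sq (mat t₁ (α * t₂) (α * t₃) (- (u * t₁ + v * b * t₄)))
    +ᴹ (b ·ᴹ sq (mat t₄ (β * t₂) (β * t₃) (u * t₄ - v * t₁))) ≡ -ᴹ I
pell-family-solution {b} {g} {α} {β} {u} {v} {t₁} {t₂} {t₃} {t₄} g≢0 u+1≡gα refl pell condition
  with refl ← a+b≡c⇒a≡c-b {u} {1ℤ} {g * α} u+1≡gα =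
  A+B≡0⇒A≡-B (k·A≡0⇒A≡0 g²≢0 (trans (pell-family-defect b g α β t₁ t₂ t₃ t₄)
    (cong₂ (λ c p → (c ·ᴹ I) +ᴹ (p ·ᴹ _)) condition (cong (_- 1ℤ) pell))))
  where
  g²≢0 : g * g ≢ 0ℤ
  g²≢0 g²≡0 with i*j≡0⇒i≡0∨j≡0 g g²≡0
  ... | inj₁ g≡0 = g≢0 g≡0
  ... | inj₂ g≡0 = g≢0 g≡0

-- The solutions of X² + bY² = −I

Traceless TracelessScalar PellFamily : ℤ → M2 → M2 → Set
Traceless b X Y = ∃ λ t₁ → ∃ λ t₂ → ∃ λ t₃ → ∃ λ s₁ → ∃ λ s₂ → ∃ λ s₃ →
  X ≡ mat t₁ t₂ t₃ (- t₁) × Y ≡ mat s₁ s₂ s₃ (- s₁) ×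
  t₁ * t₁ + t₂ * t₃ + b * (s₁ * s₁ + s₂ * s₃) ≡ - 1ℤ
TracelessScalar b X Y = ∃ λ t₁ → ∃ λ t₂ → ∃ λ t₃ → ∃ λ t₄ →
  X ≡ mat t₁ t₂ t₃ (- t₁) × Y ≡ t₄ ·ᴹ I ×
  t₁ * t₁ + t₂ * t₃ + b * (t₄ * t₄) ≡ - 1ℤ
PellFamily b X Y = ∃ λ t₁ → ∃ λ t₂ → ∃ λ t₃ → ∃ λ t₄ → ∃ λ u → ∃ λ v →
  u ≢ - 1ℤ × (∃ λ α → ∃ λ β →
  u + 1ℤ ≡ gcd v (u + 1ℤ) * α × v ≡ gcd v (u + 1ℤ) * β ×
  X ≡ mat t₁ (α * t₂) (α * t₃) (- (u * t₁ + v * b * t₄)) ×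
  Y ≡ mat t₄ (β * t₂) (β * t₃) (u * t₄ - v * t₁) ×
  u * u + v * v * b ≡ 1ℤ ×
  gcd v (u + 1ℤ) * gcd v (u + 1ℤ) * (t₁ * t₁ + b * (t₄ * t₄) + 1ℤ) + (+ 2) * t₂ * t₃ * (1ℤ + u) ≡ 0ℤ)

SolutionForms : ℤ → M2 → M2 → Set
SolutionForms b X Y = Traceless b X Y ⊎ (0ℤ < b × TracelessScalar b X Y) ⊎ (b < 0ℤ × PellFamily b X Y)

module Solution {b : ℤ} {X Y : M2} (sol : sq X +ᴹ (b ·ᴹ sq Y) ≡ -ᴹ I) where

  open ≡-Reasoning

  x₁ x₂ x₃ y₁ y₂ y₃ : ℤ
  x₁ = a₁₁ X ; x₂ = a₁₂ X ; x₃ = a₂₁ X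
  y₁ = a₁₁ Y ; y₂ = a₁₂ Y ; y₃ = a₂₁ Y

  entry₁₁ : x₁ * x₁ + x₂ * x₃ + b * (y₁ * y₁ + y₂ * y₃) ≡ - 1ℤ
  entry₁₁ = cong a₁₁ sol

  X²+bY²+I≡0 : (sq X +ᴹ (b ·ᴹ sq Y)) +ᴹ I ≡ 0ᴹ
  X²+bY²+I≡0 = cong (_+ᴹ I) sol

  trX·⁅X,Y⁆≡0 : tr X ·ᴹ ⁅ X , Y ⁆ ≡ 0ᴹ
  trX·⁅X,Y⁆≡0 = begin
    tr X ·ᴹ ⁅ X , Y ⁆             ≡⟨ ⁅X²+bY²,Y⁆≡trX·⁅X,Y⁆ b X Y ⟨
    ⁅ sq X +ᴹ (b ·ᴹ sq Y) , Y ⁆   ≡⟨ cong (λ A → ⁅ A , Y ⁆) sol ⟩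
    ⁅ -ᴹ I , Y ⁆                  ≡⟨ ⁅-I,A⁆≡0 Y ⟩
    0ᴹ                            ∎

  b·trY·⁅X,Y⁆≡0 : (b * tr Y) ·ᴹ ⁅ X , Y ⁆ ≡ 0ᴹ
  b·trY·⁅X,Y⁆≡0 = begin
    (b * tr Y) ·ᴹ ⁅ X , Y ⁆       ≡⟨ ⁅X,X²+bY²⁆≡b·trY·⁅X,Y⁆ b X Y ⟨
    ⁅ X , sq X +ᴹ (b ·ᴹ sq Y) ⁆   ≡⟨ cong (λ A → ⁅ X , A ⁆) sol ⟩
    ⁅ X , -ᴹ I ⁆                  ≡⟨ ⁅A,-I⁆≡0 X ⟩
    0ᴹ                            ∎

  commute : b ≢ 0ℤ → tr X ≢ 0ℤ ⊎ tr Y ≢ 0ℤ → ⁅ X , Y ⁆ ≡ 0ᴹ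
  commute _   (inj₁ trX≢0) = k·A≡0⇒A≡0 trX≢0 trX·⁅X,Y⁆≡0
  commute b≢0 (inj₂ trY≢0) = k·A≡0⇒A≡0 b·trY≢0 b·trY·⁅X,Y⁆≡0
    where
    b·trY≢0 : b * tr Y ≢ 0ℤ
    b·trY≢0 b·trY≡0 with i*j≡0⇒i≡0∨j≡0 b b·trY≡0
    ... | inj₁ b≡0   = b≢0 b≡0
    ... | inj₂ trY≡0 = trY≢0 trY≡0

  traceless : tr X ≡ 0ℤ → tr Y ≡ 0ℤ → Traceless b X Y
  traceless trX≡0 trY≡0 =
    x₁ , x₂ , x₃ , y₁ , y₂ , y₃ , tr≡0⇒traceless trX≡0 , tr≡0⇒traceless trY≡0 , entry₁₁

  adj-X≡ : ⁅ X , Y ⁆ ≡ 0ᴹ → adj X ≡ -ᴹ ((detRe b X Y ·ᴹ X) +ᴹ ((detIm X Y * b) ·ᴹ Y))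
  adj-X≡ ⁅X,Y⁆≡0 = trans (proj₁ (commuting-identities b X Y))
    (R+[A·P+B·Q]≡R (-ᴹ ((detRe b X Y ·ᴹ X) +ᴹ ((detIm X Y * b) ·ᴹ Y))) (adj X) (b ·ᴹ adj Y) X²+bY²+I≡0 ⁅X,Y⁆≡0)

  adj-Y≡ : ⁅ X , Y ⁆ ≡ 0ᴹ → adj Y ≡ (detRe b X Y ·ᴹ Y) -ᴹ (detIm X Y ·ᴹ X)
  adj-Y≡ ⁅X,Y⁆≡0 = trans (proj₁ (proj₂ (commuting-identities b X Y)))
    (R+[A·P+B·Q]≡R ((detRe b X Y ·ᴹ Y) -ᴹ (detIm X Y ·ᴹ X)) (adj Y) (-ᴹ adj X) X²+bY²+I≡0 ⁅X,Y⁆≡0)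

  pell : ⁅ X , Y ⁆ ≡ 0ᴹ → detRe b X Y * detRe b X Y + detIm X Y * detIm X Y * b ≡ 1ℤ
  pell ⁅X,Y⁆≡0 = begin
    detRe b X Y * detRe b X Y + detIm X Y * detIm X Y * b ≡⟨ proj₂ (proj₂ (commuting-identities b X Y)) ⟩
    1ℤ + (det E - tr E) - b * det ⁅ X , Y ⁆                ≡⟨ cong₂ (λ P Q → 1ℤ + (det P - tr P) - b * det Q) X²+bY²+I≡0 ⁅X,Y⁆≡0 ⟩
    1ℤ - b * 0ℤ                                            ≡⟨ cong (λ z → 1ℤ - z) (*-zeroʳ b) ⟩
    1ℤ                                                     ∎
    where
    E : M2
    E = (sq X +ᴹ (b ·ᴹ sq Y)) +ᴹ I

  module PellRelations (u v : ℤ) (adjX≡ : adj X ≡ -ᴹ ((u ·ᴹ X) +ᴹ ((v * b) ·ᴹ Y)))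
                       (adjY≡ : adj Y ≡ (u ·ᴹ Y) -ᴹ (v ·ᴹ X)) (pell : u * u + v * v * b ≡ 1ℤ) where

    u≢-1 : b ≢ 0ℤ → HasPrime3mod4Divisor b → u ≢ - 1ℤ
    u≢-1 b≢0 hp u≡-1 = x²+bk≢-1 {b} hp x₁ (y₁ * y₁ + y₂ * y₃) (begin
      x₁ * x₁ + b * (y₁ * y₁ + y₂ * y₃)              ≡⟨ cong (_+ b * (y₁ * y₁ + y₂ * y₃)) (+-identityʳ (x₁ * x₁)) ⟨
      x₁ * x₁ + 0ℤ * x₃ + b * (y₁ * y₁ + y₂ * y₃)    ≡⟨ cong (λ z → x₁ * x₁ + z * x₃ + b * (y₁ * y₁ + y₂ * y₃)) x₂≡0 ⟨
      x₁ * x₁ + x₂ * x₃ + b * (y₁ * y₁ + y₂ * y₃)    ≡⟨ entry₁₁ ⟩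
      - 1ℤ                                           ∎)
      where
      adjX≡X : adj X ≡ X
      adjX≡X = trans adjX≡ (trans (cong₂ (λ u v → -ᴹ ((u ·ᴹ X) +ᴹ ((v * b) ·ᴹ Y))) u≡-1 (u≡-1∧pell⇒v≡0 {b} {u} {v} b≢0 u≡-1 pell))
                                 (-[-1·X+0·Y]≡X X Y))
      x₂≡0 : x₂ ≡ 0ℤ
      x₂≡0 = -x≡x⇒x≡0 (cong a₁₂ adjX≡X)

    traceless-scalar : 0ℤ < b → b ≢ 1ℤ → u ≢ - 1ℤ → TracelessScalar b X Y
    traceless-scalar 0<b b≢1 u≢-1 with u²+v²b≡1⇒u≡±1∧v≡0 {b} {u} {v} 0<b b≢1 pell
    ... | inj₂ u≡-1 , _ = ⊥-elim (u≢-1 u≡-1)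
    ... | inj₁ u≡1 , v≡0 = x₁ , x₂ , x₃ , y₁ , adj≡-A⇒traceless adjX≡-X , adj≡A⇒scalar adjY≡Y , condition
      where
      adjX≡-X : adj X ≡ -ᴹ X
      adjX≡-X = trans adjX≡ (trans (cong₂ (λ u v → -ᴹ ((u ·ᴹ X) +ᴹ ((v * b) ·ᴹ Y))) u≡1 v≡0) (-[1·X+0·Y]≡-X X Y))
      adjY≡Y : adj Y ≡ Y
      adjY≡Y = trans adjY≡ (trans (cong₂ (λ u v → (u ·ᴹ Y) -ᴹ (v ·ᴹ X)) u≡1 v≡0) (1·Y-0·X≡Y X Y))
      y₂≡0 : y₂ ≡ 0ℤ
      y₂≡0 = -x≡x⇒x≡0 (cong a₁₂ adjY≡Y)
      condition : x₁ * x₁ + x₂ * x₃ + b * (y₁ * y₁) ≡ - 1ℤ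
      condition = begin
        x₁ * x₁ + x₂ * x₃ + b * (y₁ * y₁)              ≡⟨ cong (λ z → x₁ * x₁ + x₂ * x₃ + b * z) (+-identityʳ (y₁ * y₁)) ⟨
        x₁ * x₁ + x₂ * x₃ + b * (y₁ * y₁ + 0ℤ * y₃)    ≡⟨ cong (λ z → x₁ * x₁ + x₂ * x₃ + b * (y₁ * y₁ + z * y₃)) y₂≡0 ⟨
        x₁ * x₁ + x₂ * x₃ + b * (y₁ * y₁ + y₂ * y₃)    ≡⟨ entry₁₁ ⟩
        - 1ℤ                                           ∎

    pell-family : u ≢ - 1ℤ → PellFamily b X Y
    pell-family u≢-1 with gcd-quotients v (u + 1ℤ) | gcd-bézout v (u + 1ℤ)
    ... | β , α , v≡gβ , u+1≡gα | a , c , g≡av+c[u+1] =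
      x₁ , t₂ , t₃ , y₁ , u , v , u≢-1 , α , β , u+1≡gα , v≡gβ ,
      mat≡ (refl , proj₁ x₂y₂ , proj₁ x₃y₃ , cong a₁₁ adjX≡) ,
      mat≡ (refl , proj₂ x₂y₂ , proj₂ x₃y₃ , cong a₁₁ adjY≡) ,
      pell , pell-family-condition {b} {gcd v (u + 1ℤ)} {α} {β} {u} {v} {x₁} {x₂} {x₃} {y₁} {y₂} {y₃} {t₂} {t₃}
               u+1≡gα v≡gβ x₂y₂ x₃y₃ pell entry₁₁
      where
      t₂ t₃ : ℤ
      t₂ = a * y₂ + c * x₂
      t₃ = a * y₃ + c * x₃
      multiples : ∀ x y → - y ≡ u * y - v * x → x ≡ α * (a * y + c * x) × y ≡ β * (a * y + c * x)
      multiples x y -y≡uy-vx = v*x≡w*y⇒multiples {gcd v (u + 1ℤ)} {a} {c} {α} {β} {v} {u + 1ℤ} {x} {y}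
        (gcd[v,u+1]≢0 {u} {v} u≢-1) u+1≡gα v≡gβ g≡av+c[u+1] (-y≡uy-vx⇒vx≡[u+1]y {u} {v} {x} {y} -y≡uy-vx)
      x₂y₂ : x₂ ≡ α * t₂ × y₂ ≡ β * t₂
      x₂y₂ = multiples x₂ y₂ (cong a₁₂ adjY≡)
      x₃y₃ : x₃ ≡ α * t₃ × y₃ ≡ β * t₃
      x₃y₃ = multiples x₃ y₃ (cong a₂₁ adjY≡)

  commuting-forms : b ≢ 0ℤ → HasPrime3mod4Divisor b → ⁅ X , Y ⁆ ≡ 0ᴹ →
                    (0ℤ < b × TracelessScalar b X Y) ⊎ (b < 0ℤ × PellFamily b X Y)
  commuting-forms b≢0 hp ⁅X,Y⁆≡0 = by-sign (<-cmp 0ℤ b)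
    where
    open PellRelations (detRe b X Y) (detIm X Y) (adj-X≡ ⁅X,Y⁆≡0) (adj-Y≡ ⁅X,Y⁆≡0) (pell ⁅X,Y⁆≡0)
    by-sign : Tri (0ℤ < b) (0ℤ ≡ b) (b < 0ℤ) → (0ℤ < b × TracelessScalar b X Y) ⊎ (b < 0ℤ × PellFamily b X Y)
    by-sign (tri< 0<b _ _) = inj₁ (0<b , traceless-scalar 0<b (HasPrime3mod4Divisor⇒≢1 hp) (u≢-1 b≢0 hp))
    by-sign (tri≈ _ 0≡b _) = ⊥-elim (b≢0 (sym 0≡b))
    by-sign (tri> _ _ b<0) = inj₂ (b<0 , pell-family (u≢-1 b≢0 hp))

  forms : b ≢ 0ℤ → HasPrime3mod4Divisor b → SolutionForms b X Y
  forms b≢0 hp with tr X ≟ 0ℤ | tr Y ≟ 0ℤ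
  ... | yes trX≡0 | yes trY≡0 = inj₁ (traceless trX≡0 trY≡0)
  ... | no trX≢0  | _         = inj₂ (commuting-forms b≢0 hp (commute b≢0 (inj₁ trX≢0)))
  ... | yes _     | no trY≢0  = inj₂ (commuting-forms b≢0 hp (commute b≢0 (inj₂ trY≢0)))

solution : ∀ {b X Y} → SolutionForms b X Y → sq X +ᴹ (b ·ᴹ sq Y) ≡ -ᴹ I
solution {b} (inj₁ (t₁ , t₂ , t₃ , s₁ , s₂ , s₃ , refl , refl , condition)) =
  scalar-solution b (mat t₁ t₂ t₃ (- t₁)) (mat s₁ s₂ s₃ (- s₁)) (t₁ * t₁ + t₂ * t₃) (s₁ * s₁ + s₂ * s₃)
    (sq-traceless t₁ t₂ t₃) (sq-traceless s₁ s₂ s₃) condition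
solution {b} (inj₂ (inj₁ (_ , t₁ , t₂ , t₃ , t₄ , refl , refl , condition))) =
  scalar-solution b (mat t₁ t₂ t₃ (- t₁)) (t₄ ·ᴹ I) (t₁ * t₁ + t₂ * t₃) (t₄ * t₄)
    (sq-traceless t₁ t₂ t₃) (sq-scalar t₄) condition
solution {b} (inj₂ (inj₂ (_ , t₁ , t₂ , t₃ , t₄ , u , v , u≢-1 , α , β , u+1≡gα , v≡gβ , refl , refl ,
                          pell , condition))) =
  pell-family-solution {b} {gcd v (u + 1ℤ)} {α} {β} {u} {v} {t₁} {t₂} {t₃} {t₄}
    (gcd[v,u+1]≢0 {u} {v} u≢-1) u+1≡gα v≡gβ pell condition

proposition4p3 : (b : ℤ) → b ≢ 0ℤ → ¬ IsSquare (- b) → HasPrime3mod4Divisor b →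
    (X Y : M2) →
    (sq X +ᴹ (b ·ᴹ sq Y) ≡ -ᴹ I)
    ⇔
    ( -- (i)
      (∃ λ t₁ → ∃ λ t₂ → ∃ λ t₃ → ∃ λ s₁ → ∃ λ s₂ → ∃ λ s₃ →
        X ≡ mat t₁ t₂ t₃ (- t₁) × Y ≡ mat s₁ s₂ s₃ (- s₁) ×
        t₁ * t₁ + t₂ * t₃ + b * (s₁ * s₁ + s₂ * s₃) ≡ - 1ℤ)
    ⊎ -- (ii), case b > 0
      (0ℤ < b × (∃ λ t₁ → ∃ λ t₂ → ∃ λ t₃ → ∃ λ t₄ →
        X ≡ mat t₁ t₂ t₃ (- t₁) × Y ≡ t₄ ·ᴹ I ×
        t₁ * t₁ + t₂ * t₃ + b * (t₄ * t₄) ≡ - 1ℤ))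
    ⊎ -- (ii), case b < 0 ; α = (u+1)/g and β = v/g (exact quotients)
      (b < 0ℤ × (∃ λ t₁ → ∃ λ t₂ → ∃ λ t₃ → ∃ λ t₄ → ∃ λ u → ∃ λ v →
        u ≢ - 1ℤ × (∃ λ α → ∃ λ β →
          u + 1ℤ ≡ gcd v (u + 1ℤ) * α × v ≡ gcd v (u + 1ℤ) * β ×
          X ≡ mat t₁ (α * t₂) (α * t₃) (- (u * t₁ + v * b * t₄)) ×
          Y ≡ mat t₄ (β * t₂) (β * t₃) (u * t₄ - v * t₁) ×
          u * u + v * v * b ≡ 1ℤ ×
          -- t₁² + b t₄² + 2 t₂ t₃ (1+u)/g² = -1, multiplied through by g² ≠ 0
          gcd v (u + 1ℤ) * gcd v (u + 1ℤ) * (t₁ * t₁ + b * (t₄ * t₄) + 1ℤ)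
            + (+ 2) * t₂ * t₃ * (1ℤ + u) ≡ 0ℤ))))
proposition4p3 b b≢0 _ hp X Y = mk⇔ (λ sol → Solution.forms sol b≢0 hp) solution
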